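{- Let $\pi\colon X\to Y$ be a map in a cartesian bicategory $\mathcal{B}$. Then $\pi$ is an epimorphism in $\mathcal{B}$ (i.e. $\pi;R=\pi;S$ implies $R=S$ for all morphisms $R,S\colon Y\to Z$ of $\mathcal{B}$) if and only if $\pi$ is surjective.
   Context: Composition is diagrammatic ($R;S$ means first $R$ then $S$). A cartesian bicategory is a (strict) symmetric monoidal category $(\mathcal{B},\otimes,I)$ with symmetry $\sigma$, enriched over posets (hom-sets ordered by $\le$, with $;$ and $\otimes$ monotone), where every object $X$ has $\delta_X\colon X\to X\otimes X$, $\varepsilon_X\colon X\to I$ such that: (1) they form a cocommutative comonoid; (2) they have right adjoints $\delta_X^*,\varepsilon_X^*$: $\mathrm{id}_X\le\delta_X;\delta_X^*$, $\delta_X^*;\delta_X\le\mathrm{id}$, $\mathrm{id}_X\le\varepsilon_X;\varepsilon_X^*$, $\varepsilon_X^*;\varepsilon_X\le\mathrm{id}_I$; (3) $\delta_X^*;\delta_X=(\mathrm{id}_X\otimes\delta_X);(\delta_X^*\otimes\mathrm{id}_X)$; (4) every $R\colon X\to Y$ satisfies $R;\delta_Y\le\delta_X;(R\otimes R)$ and $R;\varepsilon_Y\le\varepsilon_X$; (5) $\varepsilon_{X\otimes Y}=\varepsilon_X\otimes\varepsilon_Y$, $\delta_{X\otimes Y}=(\delta_X\otimes\delta_Y);(\mathrm{id}\otimes\sigma_{X,Y}\otimes\mathrm{id})$, $\varepsilon_I=\delta_I=\mathrm{id}_I$. A map is a morphism $f\colon X\to Y$ with $\delta_X;(f\otimes f)\le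 f;\delta_Y$ and $\varepsilon_X\le f;\varepsilon_Y$. A morphism $R\colon X\to Y$ is surjective if $\varepsilon_Y^*\le\varepsilon_X^*;R$. -}

module Defs where

open import Level using (Level; _⊔_; suc)
open import Relation.Binary.PropositionalEquality using (_≡_; subst; sym)
open import Data.Product using (_×_)

-- Cartesian bicategory (composition diagrammatic: f ⨾ g = first f then g).
-- Strict symmetric monoidal category, hom-sets partially ordered (poset
-- enrichment), with strictness expressed by equalities of objects; the
-- canonical "identity" morphisms between propositionally equal objects are
-- written ⟦ p ⟧ (transport of the identity along p).
record CartesianBicategory (o h ℓ : Level) : Set (suc (o ⊔ h ⊔ ℓ)) where
  infixr 9 _⨾_
  infixr 10 _⊗_ _⊗₀_
  infix 4 _≤_
  field
    Ob   : Set o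
    Hom  : Ob → Ob → Set h
    _≤_  : ∀ {X Y} → Hom X Y → Hom X Y → Set ℓ
    id   : ∀ X → Hom X X
    _⨾_  : ∀ {X Y Z} → Hom X Y → Hom Y Z → Hom X Z
    ⨾-assoc : ∀ {W X Y Z} (f : Hom W X) (g : Hom X Y) (k : Hom Y Z) →
              (f ⨾ g) ⨾ k ≡ f ⨾ (g ⨾ k)
    ⨾-idˡ : ∀ {X Y} (f : Hom X Y) → id X ⨾ f ≡ f
    ⨾-idʳ : ∀ {X Y} (f : Hom X Y) → f ⨾ id Y ≡ f
    ≤-refl    : ∀ {X Y} {f : Hom X Y} → f ≤ f
    ≤-trans   : ∀ {X Y} {f g k : Hom X Y} → f ≤ g → g ≤ k → f ≤ k
    ≤-antisym : ∀ {X Y} {f g : Hom X Y} → f ≤ g → g ≤ f → f ≡ g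
    ⨾-mono    : ∀ {X Y Z} {f f' : Hom X Y} {g g' : Hom Y Z} →
                f ≤ f' → g ≤ g' → f ⨾ g ≤ f' ⨾ g'
    _⊗₀_ : Ob → Ob → Ob
    I    : Ob
    ⊗₀-assoc : ∀ X Y Z → (X ⊗₀ Y) ⊗₀ Z ≡ X ⊗₀ (Y ⊗₀ Z)
    ⊗₀-unitˡ : ∀ X → I ⊗₀ X ≡ X
    ⊗₀-unitʳ : ∀ X → X ⊗₀ I ≡ X
    _⊗_  : ∀ {X Y X' Y'} → Hom X Y → Hom X' Y' → Hom (X ⊗₀ X') (Y ⊗₀ Y')
    ⊗-id : ∀ X Y → id X ⊗ id Y ≡ id (X ⊗₀ Y)
    ⊗-⨾  : ∀ {X Y Z X' Y' Z'} (f : Hom X Y) (g : Hom Y Z)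
             (f' : Hom X' Y') (g' : Hom Y' Z') →
           (f ⨾ g) ⊗ (f' ⨾ g') ≡ (f ⊗ f') ⨾ (g ⊗ g')
    ⊗-mono : ∀ {X Y X' Y'} {f g : Hom X Y} {f' g' : Hom X' Y'} →
             f ≤ g → f' ≤ g' → f ⊗ f' ≤ g ⊗ g'

  ⟦_⟧ : ∀ {X Y} → X ≡ Y → Hom X Y
  ⟦_⟧ {X} p = subst (Hom X) p (id X)

  α : ∀ X Y Z → Hom ((X ⊗₀ Y) ⊗₀ Z) (X ⊗₀ (Y ⊗₀ Z))
  α X Y Z = ⟦ ⊗₀-assoc X Y Z ⟧

  α⁻ : ∀ X Y Z → Hom (X ⊗₀ (Y ⊗₀ Z)) ((X ⊗₀ Y) ⊗₀ Z)
  α⁻ X Y Z = ⟦ sym (⊗₀-assoc X Y Z) ⟧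

  λ⁺ : ∀ X → Hom (I ⊗₀ X) X
  λ⁺ X = ⟦ ⊗₀-unitˡ X ⟧

  λ⁻ : ∀ X → Hom X (I ⊗₀ X)
  λ⁻ X = ⟦ sym (⊗₀-unitˡ X) ⟧

  ρ⁺ : ∀ X → Hom (X ⊗₀ I) X
  ρ⁺ X = ⟦ ⊗₀-unitʳ X ⟧

  ρ⁻ : ∀ X → Hom X (X ⊗₀ I)
  ρ⁻ X = ⟦ sym (⊗₀-unitʳ X) ⟧

  field
    ⊗-assoc : ∀ {X Y Z X' Y' Z'} (f : Hom X X') (g : Hom Y Y') (k : Hom Z Z') →
              ((f ⊗ g) ⊗ k) ⨾ α X' Y' Z' ≡ α X Y Z ⨾ (f ⊗ (g ⊗ k))
    ⊗-unitˡ : ∀ {X Y} (f : Hom X Y) → (id I ⊗ f) ⨾ λ⁺ Y ≡ λ⁺ X ⨾ f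
    ⊗-unitʳ : ∀ {X Y} (f : Hom X Y) → (f ⊗ id I) ⨾ ρ⁺ Y ≡ ρ⁺ X ⨾ f
    σ : ∀ X Y → Hom (X ⊗₀ Y) (Y ⊗₀ X)
    σ-natural : ∀ {X Y X' Y'} (f : Hom X Y) (g : Hom X' Y') →
                (f ⊗ g) ⨾ σ Y Y' ≡ σ X X' ⨾ (g ⊗ f)
    σ-involutive : ∀ X Y → σ X Y ⨾ σ Y X ≡ id (X ⊗₀ Y)
    σ-hexagon : ∀ X Y Z →
      α⁻ X Y Z ⨾ (σ X Y ⊗ id Z) ⨾ α Y X Z ⨾ (id Y ⊗ σ X Z)
        ≡ σ X (Y ⊗₀ Z) ⨾ α Y Z X
    δ  : ∀ X → Hom X (X ⊗₀ X)
    ε  : ∀ X → Hom X I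
    δ* : ∀ X → Hom (X ⊗₀ X) X
    ε* : ∀ X → Hom I X
    δ-coassoc : ∀ X → δ X ⨾ (δ X ⊗ id X) ⨾ α X X X ≡ δ X ⨾ (id X ⊗ δ X)
    δ-counitˡ : ∀ X → δ X ⨾ (ε X ⊗ id X) ≡ λ⁻ X
    δ-counitʳ : ∀ X → δ X ⨾ (id X ⊗ ε X) ≡ ρ⁻ X
    δ-cocomm  : ∀ X → δ X ⨾ σ X X ≡ δ X
    δ-unit   : ∀ X → id X ≤ δ X ⨾ δ* X
    δ-counit : ∀ X → δ* X ⨾ δ X ≤ id (X ⊗₀ X)
    ε-unit   : ∀ X → id X ≤ ε X ⨾ ε* X
    ε-counit : ∀ X → ε* X ⨾ ε X ≤ id I
    frobenius : ∀ X → δ* X ⨾ δ X ≡ (id X ⊗ δ X) ⨾ α⁻ X X X ⨾ (δ* X ⊗ id X)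
    δ-lax : ∀ {X Y} (R : Hom X Y) → R ⨾ δ Y ≤ δ X ⨾ (R ⊗ R)
    ε-lax : ∀ {X Y} (R : Hom X Y) → R ⨾ ε Y ≤ ε X
    ε-⊗ : ∀ X Y → ε (X ⊗₀ Y) ≡ (ε X ⊗ ε Y) ⨾ λ⁺ I
    δ-⊗ : ∀ X Y → δ (X ⊗₀ Y) ≡
      (δ X ⊗ δ Y) ⨾ α X X (Y ⊗₀ Y)
        ⨾ (id X ⊗ (α⁻ X Y Y ⨾ (σ X Y ⊗ id Y) ⨾ α Y X Y))
        ⨾ α⁻ X Y (X ⊗₀ Y)
    ε-I : ε I ≡ id I
    δ-I : δ I ≡ λ⁻ I

  IsMap : ∀ {X Y} → Hom X Y → Set ℓ
  IsMap {X} {Y} f = (δ X ⨾ (f ⊗ f) ≤ f ⨾ δ Y) × (ε X ≤ f ⨾ ε Y)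

  IsSurjective : ∀ {X Y} → Hom X Y → Set ℓ
  IsSurjective {X} {Y} R = ε* Y ≤ ε* X ⨾ R

  IsEpi : ∀ {X Y} → Hom X Y → Set (o ⊔ h)
  IsEpi {X} {Y} π = ∀ Z (R S : Hom Y Z) → π ⨾ R ≡ π ⨾ S → R ≡ S

{-# OPTIONS --safe #-}
-- Let T = ε*_X ⨾ π be the image of π, a point I → Y, and restrict T the partial
-- identity on it. Lax naturality of δ alone gives π ⨾ restrict T = π, so for an
-- epimorphism restrict T = id, and then ε*_Y = ε*_Y ⨾ restrict T ≤ T. Conversely,
-- surjectivity forces restrict T = id; for a map π the Frobenius law factors
-- restrict T as G ⨾ π, so π is a split epimorphism.
module Submission where

open import Defs
open import Data.Product using (_×_; _,_; Σ-syntax; proj₁; proj₂)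
open import Relation.Binary.Bundles using (Poset)
open import Relation.Binary.PropositionalEquality
  using (_≡_; refl; sym; trans; cong; isEquivalence; module ≡-Reasoning)
import Relation.Binary.Reasoning.PartialOrder as PosetReasoning

module CartesianBicategoryProperties {o h ℓ} (B : CartesianBicategory o h ℓ) where
  open CartesianBicategory B

  homPoset : Ob → Ob → Poset h h ℓ
  homPoset X Y = record
    { Carrier        = Hom X Y
    ; _≈_            = _≡_
    ; _≤_            = _≤_
    ; isPartialOrder = record
      { isPreorder = record
        { isEquivalence = isEquivalence
        ; reflexive     = λ { refl → ≤-refl }
        ; trans         = ≤-trans
        }
      ; antisym = ≤-antisym
      }
    }

  module ≤-Reasoning {X Y : Ob} = PosetReasoning (homPoset X Y)

  ⨾-pullˡ : ∀ {A C D E} {a : Hom A C} {b : Hom C D} {c : Hom A D} (r : Hom D E) →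
            a ⨾ b ≡ c → a ⨾ b ⨾ r ≡ c ⨾ r
  ⨾-pullˡ {a = a} {b} r e = trans (sym (⨾-assoc a b r)) (cong (_⨾ r) e)

  ⨾-cancelˡ : ∀ {A C D} {a : Hom A C} {b : Hom C A} (r : Hom A D) →
              a ⨾ b ≡ id A → a ⨾ b ⨾ r ≡ r
  ⨾-cancelˡ r e = trans (⨾-pullˡ r e) (⨾-idˡ r)

  id⊗-⨾ : ∀ {A C D E} (f : Hom C D) (g : Hom D E) →
          id A ⊗ (f ⨾ g) ≡ (id A ⊗ f) ⨾ (id A ⊗ g)
  id⊗-⨾ {A} f g = trans (cong (_⊗ (f ⨾ g)) (sym (⨾-idˡ (id A)))) (⊗-⨾ (id A) (id A) f g)

  ⨾-⊗id : ∀ {A C D E} (f : Hom C D) (g : Hom D E) →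
          (f ⨾ g) ⊗ id A ≡ (f ⊗ id A) ⨾ (g ⊗ id A)
  ⨾-⊗id {A} f g = trans (cong ((f ⨾ g) ⊗_) (sym (⨾-idˡ (id A)))) (⊗-⨾ f g (id A) (id A))

  serialize₁₂ : ∀ {A A' C C'} (f : Hom A C) (g : Hom A' C') →
                f ⊗ g ≡ (f ⊗ id A') ⨾ (id C ⊗ g)
  serialize₁₂ f g =
    trans (cong (_⊗ g) (sym (⨾-idʳ f))) (trans (cong ((f ⨾ _) ⊗_) (sym (⨾-idˡ g))) (⊗-⨾ f (id _) (id _) g))

  serialize₂₁ : ∀ {A A' C C'} (f : Hom A C) (g : Hom A' C') →
                f ⊗ g ≡ (id A ⊗ g) ⨾ (f ⊗ id C')
  serialize₂₁ f g =
    trans (cong (_⊗ g) (sym (⨾-idˡ f))) (trans (cong ((_ ⨾ f) ⊗_) (sym (⨾-idʳ g))) (⊗-⨾ (id _) f g (id _)))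

  ⟦sym⟧⨾⟦⟧ : ∀ {A C} (p : A ≡ C) → ⟦ sym p ⟧ ⨾ ⟦ p ⟧ ≡ id C
  ⟦sym⟧⨾⟦⟧ refl = ⨾-idˡ _

  ⟦⟧-conjugate : ∀ {A A' C C'} (p : A ≡ A') (q : C ≡ C') {f : Hom A C} {g : Hom A' C'} →
                 f ⨾ ⟦ q ⟧ ≡ ⟦ p ⟧ ⨾ g → g ⨾ ⟦ sym q ⟧ ≡ ⟦ sym p ⟧ ⨾ f
  ⟦⟧-conjugate refl refl {f} {g} e = begin
    g ⨾ id _  ≡⟨ ⨾-idʳ g ⟩
    g         ≡⟨ ⨾-idˡ g ⟨
    id _ ⨾ g  ≡⟨ e ⟨
    f ⨾ id _  ≡⟨ ⨾-idʳ f ⟩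
    f         ≡⟨ ⨾-idˡ f ⟨
    id _ ⨾ f  ∎
    where open ≡-Reasoning

  ρ⁻-natural : ∀ {A C} (f : Hom A C) → f ⨾ ρ⁻ C ≡ ρ⁻ A ⨾ (f ⊗ id I)
  ρ⁻-natural {A} {C} f = ⟦⟧-conjugate (⊗₀-unitʳ A) (⊗₀-unitʳ C) (⊗-unitʳ f)

  α⁻-natural : ∀ {A C D A' C' D'} (a : Hom A A') (b : Hom C C') (c : Hom D D') →
               (a ⊗ (b ⊗ c)) ⨾ α⁻ A' C' D' ≡ α⁻ A C D ⨾ ((a ⊗ b) ⊗ c)
  α⁻-natural {A} {C} {D} {A'} {C'} {D'} a b c =
    ⟦⟧-conjugate (⊗₀-assoc A C D) (⊗₀-assoc A' C' D') (⊗-assoc a b c)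

  ρ⁻I≡λ⁻I : ρ⁻ I ≡ λ⁻ I
  ρ⁻I≡λ⁻I = begin
    ρ⁻ I                    ≡⟨ δ-counitʳ I ⟨
    δ I ⨾ (id I ⊗ ε I)      ≡⟨ cong (λ k → δ I ⨾ (id I ⊗ k)) ε-I ⟩
    δ I ⨾ (id I ⊗ id I)     ≡⟨ cong (δ I ⨾_) (⊗-id I I) ⟩
    δ I ⨾ id (I ⊗₀ I)       ≡⟨ ⨾-idʳ (δ I) ⟩
    δ I                     ≡⟨ δ-I ⟩
    λ⁻ I                    ∎
    where open ≡-Reasoning

  point≤ε* : ∀ {A} (T : Hom I A) → T ≤ ε* A
  point≤ε* {A} T = begin
    T                  ≡⟨ ⨾-idʳ T ⟨
    T ⨾ id A           ≤⟨ ⨾-mono ≤-refl (ε-unit A) ⟩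
    T ⨾ ε A ⨾ ε* A     ≡⟨ ⨾-assoc T (ε A) (ε* A) ⟨
    (T ⨾ ε A) ⨾ ε* A   ≤⟨ ⨾-mono (ε-lax T) ≤-refl ⟩
    ε I ⨾ ε* A         ≡⟨ cong (_⨾ ε* A) ε-I ⟩
    id I ⨾ ε* A        ≡⟨ ⨾-idˡ (ε* A) ⟩
    ε* A               ∎
    where open ≤-Reasoning

  id⊗ε*⨾δ*≤ρ⁺ : ∀ A → (id A ⊗ ε* A) ⨾ δ* A ≤ ρ⁺ A
  id⊗ε*⨾δ*≤ρ⁺ A = begin
    (id A ⊗ ε* A) ⨾ δ* A
      ≡⟨ cong ((id A ⊗ ε* A) ⨾_) (trans (cong (δ* A ⨾_) (⟦sym⟧⨾⟦⟧ (⊗₀-unitʳ A))) (⨾-idʳ (δ* A))) ⟨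
    (id A ⊗ ε* A) ⨾ δ* A ⨾ ρ⁻ A ⨾ ρ⁺ A
      ≡⟨ cong (λ k → (id A ⊗ ε* A) ⨾ δ* A ⨾ k ⨾ ρ⁺ A) (δ-counitʳ A) ⟨
    (id A ⊗ ε* A) ⨾ δ* A ⨾ (δ A ⨾ (id A ⊗ ε A)) ⨾ ρ⁺ A
      ≡⟨ cong ((id A ⊗ ε* A) ⨾_) (trans (cong (δ* A ⨾_) (⨾-assoc _ _ _)) (sym (⨾-assoc _ _ _))) ⟩
    (id A ⊗ ε* A) ⨾ (δ* A ⨾ δ A) ⨾ (id A ⊗ ε A) ⨾ ρ⁺ A
      ≤⟨ ⨾-mono ≤-refl (⨾-mono (δ-counit A) ≤-refl) ⟩
    (id A ⊗ ε* A) ⨾ id (A ⊗₀ A) ⨾ (id A ⊗ ε A) ⨾ ρ⁺ A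
      ≡⟨ cong ((id A ⊗ ε* A) ⨾_) (⨾-idˡ _) ⟩
    (id A ⊗ ε* A) ⨾ (id A ⊗ ε A) ⨾ ρ⁺ A
      ≡⟨ ⨾-pullˡ (ρ⁺ A) (sym (id⊗-⨾ (ε* A) (ε A))) ⟩
    (id A ⊗ (ε* A ⨾ ε A)) ⨾ ρ⁺ A
      ≤⟨ ⨾-mono (⊗-mono ≤-refl (ε-counit A)) ≤-refl ⟩
    (id A ⊗ id I) ⨾ ρ⁺ A
      ≡⟨ trans (cong (_⨾ ρ⁺ A) (⊗-id A I)) (⨾-idˡ (ρ⁺ A)) ⟩
    ρ⁺ A ∎
    where open ≤-Reasoning

  ε*⊗id⨾δ*≤λ⁺ : ∀ A → (ε* A ⊗ id A) ⨾ δ* A ≤ λ⁺ A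
  ε*⊗id⨾δ*≤λ⁺ A = begin
    (ε* A ⊗ id A) ⨾ δ* A
      ≡⟨ cong ((ε* A ⊗ id A) ⨾_) (trans (cong (δ* A ⨾_) (⟦sym⟧⨾⟦⟧ (⊗₀-unitˡ A))) (⨾-idʳ (δ* A))) ⟨
    (ε* A ⊗ id A) ⨾ δ* A ⨾ λ⁻ A ⨾ λ⁺ A
      ≡⟨ cong (λ k → (ε* A ⊗ id A) ⨾ δ* A ⨾ k ⨾ λ⁺ A) (δ-counitˡ A) ⟨
    (ε* A ⊗ id A) ⨾ δ* A ⨾ (δ A ⨾ (ε A ⊗ id A)) ⨾ λ⁺ A
      ≡⟨ cong ((ε* A ⊗ id A) ⨾_) (trans (cong (δ* A ⨾_) (⨾-assoc _ _ _)) (sym (⨾-assoc _ _ _))) ⟩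
    (ε* A ⊗ id A) ⨾ (δ* A ⨾ δ A) ⨾ (ε A ⊗ id A) ⨾ λ⁺ A
      ≤⟨ ⨾-mono ≤-refl (⨾-mono (δ-counit A) ≤-refl) ⟩
    (ε* A ⊗ id A) ⨾ id (A ⊗₀ A) ⨾ (ε A ⊗ id A) ⨾ λ⁺ A
      ≡⟨ cong ((ε* A ⊗ id A) ⨾_) (⨾-idˡ _) ⟩
    (ε* A ⊗ id A) ⨾ (ε A ⊗ id A) ⨾ λ⁺ A
      ≡⟨ ⨾-pullˡ (λ⁺ A) (sym (⨾-⊗id (ε* A) (ε A))) ⟩
    ((ε* A ⨾ ε A) ⊗ id A) ⨾ λ⁺ A
      ≤⟨ ⨾-mono (⊗-mono (ε-counit A) ≤-refl) ≤-refl ⟩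
    (id I ⊗ id A) ⨾ λ⁺ A
      ≡⟨ trans (cong (_⨾ λ⁺ A) (⊗-id I A)) (⨾-idˡ (λ⁺ A)) ⟩
    λ⁺ A ∎
    where open ≤-Reasoning

  -- In relations: the partial identity on the subset T ⊆ A.
  restrict : ∀ {A} → Hom I A → Hom A A
  restrict {A} T = ρ⁻ A ⨾ (id A ⊗ T) ⨾ δ* A

  restrict≤id : ∀ {A} (T : Hom I A) → restrict T ≤ id A
  restrict≤id {A} T = begin
    ρ⁻ A ⨾ (id A ⊗ T) ⨾ δ* A     ≤⟨ ⨾-mono ≤-refl (⨾-mono (⊗-mono ≤-refl (point≤ε* T)) ≤-refl) ⟩
    ρ⁻ A ⨾ (id A ⊗ ε* A) ⨾ δ* A  ≤⟨ ⨾-mono ≤-refl (id⊗ε*⨾δ*≤ρ⁺ A) ⟩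
    ρ⁻ A ⨾ ρ⁺ A                  ≡⟨ ⟦sym⟧⨾⟦⟧ (⊗₀-unitʳ A) ⟩
    id A                         ∎
    where open ≤-Reasoning

  ε*≤⇒id≤restrict : ∀ {A} (T : Hom I A) → ε* A ≤ T → id A ≤ restrict T
  ε*≤⇒id≤restrict {A} T ε*≤T = begin
    id A                             ≤⟨ δ-unit A ⟩
    δ A ⨾ δ* A                       ≡⟨ cong (δ A ⨾_) (trans (cong (_⨾ δ* A) (⊗-id A A)) (⨾-idˡ (δ* A))) ⟨
    δ A ⨾ (id A ⊗ id A) ⨾ δ* A       ≤⟨ ⨾-mono ≤-refl (⨾-mono (⊗-mono ≤-refl id≤ε⨾T) ≤-refl) ⟩
    δ A ⨾ (id A ⊗ (ε A ⨾ T)) ⨾ δ* A  ≡⟨ cong (λ k → δ A ⨾ k ⨾ δ* A) (id⊗-⨾ (ε A) T) ⟩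
    δ A ⨾ ((id A ⊗ ε A) ⨾ (id A ⊗ T)) ⨾ δ* A
                                     ≡⟨ cong (δ A ⨾_) (⨾-assoc _ _ _) ⟩
    δ A ⨾ (id A ⊗ ε A) ⨾ (id A ⊗ T) ⨾ δ* A
                                     ≡⟨ ⨾-pullˡ _ (δ-counitʳ A) ⟩
    ρ⁻ A ⨾ (id A ⊗ T) ⨾ δ* A         ∎
    where
    open ≤-Reasoning
    id≤ε⨾T : id A ≤ ε A ⨾ T
    id≤ε⨾T = ≤-trans (ε-unit A) (⨾-mono ≤-refl ε*≤T)

  ⨾-restrict : ∀ {A C} (f : Hom A C) (T : Hom I C) →
               f ⨾ restrict T ≡ ρ⁻ A ⨾ (f ⊗ T) ⨾ δ* C
  ⨾-restrict {A} {C} f T = begin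
    f ⨾ ρ⁻ C ⨾ (id C ⊗ T) ⨾ δ* C              ≡⟨ ⨾-pullˡ _ (ρ⁻-natural f) ⟩
    (ρ⁻ A ⨾ (f ⊗ id I)) ⨾ (id C ⊗ T) ⨾ δ* C   ≡⟨ ⨾-assoc _ _ _ ⟩
    ρ⁻ A ⨾ (f ⊗ id I) ⨾ (id C ⊗ T) ⨾ δ* C     ≡⟨ cong (ρ⁻ A ⨾_) (⨾-pullˡ (δ* C) (sym (serialize₁₂ f T))) ⟩
    ρ⁻ A ⨾ (f ⊗ T) ⨾ δ* C                     ∎
    where open ≡-Reasoning

  ε*⨾restrict≤ : ∀ {A} (T : Hom I A) → ε* A ⨾ restrict T ≤ T
  ε*⨾restrict≤ {A} T = begin
    ε* A ⨾ restrict T                        ≡⟨ ⨾-restrict (ε* A) T ⟩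
    ρ⁻ I ⨾ (ε* A ⊗ T) ⨾ δ* A                 ≡⟨ cong (ρ⁻ I ⨾_) (⨾-pullˡ (δ* A) (sym (serialize₂₁ (ε* A) T))) ⟨
    ρ⁻ I ⨾ (id I ⊗ T) ⨾ (ε* A ⊗ id A) ⨾ δ* A  ≤⟨ ⨾-mono ≤-refl (⨾-mono ≤-refl (ε*⊗id⨾δ*≤λ⁺ A)) ⟩
    ρ⁻ I ⨾ (id I ⊗ T) ⨾ λ⁺ A                 ≡⟨ cong (ρ⁻ I ⨾_) (⊗-unitˡ T) ⟩
    ρ⁻ I ⨾ λ⁺ I ⨾ T                          ≡⟨ cong (λ k → k ⨾ λ⁺ I ⨾ T) ρ⁻I≡λ⁻I ⟩
    λ⁻ I ⨾ λ⁺ I ⨾ T                          ≡⟨ ⨾-cancelˡ T (⟦sym⟧⨾⟦⟧ (⊗₀-unitˡ I)) ⟩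
    T                                        ∎
    where open ≤-Reasoning

  restrict-image-⨾ : ∀ {X Y} (π : Hom X Y) → π ⨾ restrict (ε* X ⨾ π) ≡ π
  restrict-image-⨾ {X} {Y} π = ≤-antisym π⨾restrict≤π π≤π⨾restrict
    where
    open ≤-Reasoning
    π⨾restrict≤π : π ⨾ restrict (ε* X ⨾ π) ≤ π
    π⨾restrict≤π = begin
      π ⨾ restrict (ε* X ⨾ π)  ≤⟨ ⨾-mono ≤-refl (restrict≤id (ε* X ⨾ π)) ⟩
      π ⨾ id Y                 ≡⟨ ⨾-idʳ π ⟩
      π                        ∎
    π≤ε⨾ε*⨾π : π ≤ ε X ⨾ ε* X ⨾ π
    π≤ε⨾ε*⨾π = begin
      π                 ≡⟨ ⨾-idˡ π ⟨
      id X ⨾ π          ≤⟨ ⨾-mono (ε-unit X) ≤-refl ⟩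
      (ε X ⨾ ε* X) ⨾ π  ≡⟨ ⨾-assoc _ _ _ ⟩
      ε X ⨾ ε* X ⨾ π    ∎
    π≤π⨾restrict : π ≤ π ⨾ restrict (ε* X ⨾ π)
    π≤π⨾restrict = begin
      π                                           ≡⟨ ⨾-idʳ π ⟨
      π ⨾ id Y                                    ≤⟨ ⨾-mono ≤-refl (δ-unit Y) ⟩
      π ⨾ δ Y ⨾ δ* Y                              ≡⟨ ⨾-assoc _ _ _ ⟨
      (π ⨾ δ Y) ⨾ δ* Y                            ≤⟨ ⨾-mono (δ-lax π) ≤-refl ⟩
      (δ X ⨾ (π ⊗ π)) ⨾ δ* Y                      ≤⟨ ⨾-mono (⨾-mono ≤-refl (⊗-mono ≤-refl π≤ε⨾ε*⨾π)) ≤-refl ⟩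
      (δ X ⨾ (π ⊗ (ε X ⨾ ε* X ⨾ π))) ⨾ δ* Y       ≡⟨ cong (λ k → (δ X ⨾ (k ⊗ (ε X ⨾ ε* X ⨾ π))) ⨾ δ* Y) (⨾-idˡ π) ⟨
      (δ X ⨾ ((id X ⨾ π) ⊗ (ε X ⨾ ε* X ⨾ π))) ⨾ δ* Y
                                                  ≡⟨ cong (λ k → (δ X ⨾ k) ⨾ δ* Y) (⊗-⨾ (id X) π (ε X) (ε* X ⨾ π)) ⟩
      (δ X ⨾ ((id X ⊗ ε X) ⨾ (π ⊗ (ε* X ⨾ π)))) ⨾ δ* Y
                                                  ≡⟨ trans (⨾-assoc _ _ _) (cong (δ X ⨾_) (⨾-assoc _ _ _)) ⟩
      δ X ⨾ (id X ⊗ ε X) ⨾ (π ⊗ (ε* X ⨾ π)) ⨾ δ* Y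
                                                  ≡⟨ ⨾-pullˡ _ (δ-counitʳ X) ⟩
      ρ⁻ X ⨾ (π ⊗ (ε* X ⨾ π)) ⨾ δ* Y              ≡⟨ ⨾-restrict π (ε* X ⨾ π) ⟨
      π ⨾ restrict (ε* X ⨾ π)                     ∎

  epi⇒surjective : ∀ {X Y} (π : Hom X Y) → IsEpi π → IsSurjective π
  epi⇒surjective {X} {Y} π epi = begin
    ε* Y                           ≡⟨ ⨾-idʳ (ε* Y) ⟨
    ε* Y ⨾ id Y                    ≡⟨ cong (ε* Y ⨾_) restrict≡id ⟨
    ε* Y ⨾ restrict (ε* X ⨾ π)     ≤⟨ ε*⨾restrict≤ (ε* X ⨾ π) ⟩
    ε* X ⨾ π                       ∎
    where
    open ≤-Reasoning
    restrict≡id : restrict (ε* X ⨾ π) ≡ id Y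
    restrict≡id = epi Y _ _ (trans (restrict-image-⨾ π) (sym (⨾-idʳ π)))

  frobenius-counit : ∀ A → (id A ⊗ δ A) ⨾ α⁻ A A A ⨾ ((δ* A ⨾ ε A) ⊗ id A) ⨾ λ⁺ A ≡ δ* A
  frobenius-counit A = begin
    (id A ⊗ δ A) ⨾ α⁻ A A A ⨾ ((δ* A ⨾ ε A) ⊗ id A) ⨾ λ⁺ A
      ≡⟨ cong (λ k → (id A ⊗ δ A) ⨾ α⁻ A A A ⨾ k ⨾ λ⁺ A) (⨾-⊗id (δ* A) (ε A)) ⟩
    (id A ⊗ δ A) ⨾ α⁻ A A A ⨾ ((δ* A ⊗ id A) ⨾ (ε A ⊗ id A)) ⨾ λ⁺ A
      ≡⟨ cong (λ k → (id A ⊗ δ A) ⨾ α⁻ A A A ⨾ k) (⨾-assoc _ _ _) ⟩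
    (id A ⊗ δ A) ⨾ α⁻ A A A ⨾ (δ* A ⊗ id A) ⨾ (ε A ⊗ id A) ⨾ λ⁺ A
      ≡⟨ trans (cong ((id A ⊗ δ A) ⨾_) (sym (⨾-assoc _ _ _))) (sym (⨾-assoc _ _ _)) ⟩
    ((id A ⊗ δ A) ⨾ α⁻ A A A ⨾ (δ* A ⊗ id A)) ⨾ (ε A ⊗ id A) ⨾ λ⁺ A
      ≡⟨ cong (_⨾ ((ε A ⊗ id A) ⨾ λ⁺ A)) (frobenius A) ⟨
    (δ* A ⨾ δ A) ⨾ (ε A ⊗ id A) ⨾ λ⁺ A
      ≡⟨ ⨾-assoc _ _ _ ⟩
    δ* A ⨾ δ A ⨾ (ε A ⊗ id A) ⨾ λ⁺ A
      ≡⟨ cong (δ* A ⨾_) (⨾-pullˡ (λ⁺ A) (δ-counitˡ A)) ⟩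
    δ* A ⨾ λ⁻ A ⨾ λ⁺ A
      ≡⟨ cong (δ* A ⨾_) (⟦sym⟧⨾⟦⟧ (⊗₀-unitˡ A)) ⟩
    δ* A ⨾ id A
      ≡⟨ ⨾-idʳ (δ* A) ⟩
    δ* A ∎
    where open ≡-Reasoning

  -- In relations: (y , x) ↦ x whenever y = π x.
  graphFilter : ∀ {X Y} → Hom X Y → Hom (Y ⊗₀ X) X
  graphFilter {X} {Y} π =
    (id Y ⊗ δ X) ⨾ α⁻ Y X X ⨾ (((id Y ⊗ π) ⨾ δ* Y ⨾ ε Y) ⊗ id X) ⨾ λ⁺ X

  graphFilter-⨾ : ∀ {X Y} (π : Hom X Y) → IsMap π → graphFilter π ⨾ π ≡ (id Y ⊗ π) ⨾ δ* Y
  graphFilter-⨾ {X} {Y} π isMap = begin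
    ((id Y ⊗ δ X) ⨾ α⁻ Y X X ⨾ (P ⊗ id X) ⨾ λ⁺ X) ⨾ π
      ≡⟨ trans (⨾-assoc _ _ _) (cong ((id Y ⊗ δ X) ⨾_) (trans (⨾-assoc _ _ _) (cong (α⁻ Y X X ⨾_) (⨾-assoc _ _ _)))) ⟩
    (id Y ⊗ δ X) ⨾ α⁻ Y X X ⨾ (P ⊗ id X) ⨾ λ⁺ X ⨾ π
      ≡⟨ cong (λ k → (id Y ⊗ δ X) ⨾ α⁻ Y X X ⨾ (P ⊗ id X) ⨾ k) (⊗-unitˡ π) ⟨
    (id Y ⊗ δ X) ⨾ α⁻ Y X X ⨾ (P ⊗ id X) ⨾ (id I ⊗ π) ⨾ λ⁺ Y
      ≡⟨ cong (λ k → (id Y ⊗ δ X) ⨾ α⁻ Y X X ⨾ k) (⨾-pullˡ (λ⁺ Y) (sym (serialize₁₂ P π))) ⟩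
    (id Y ⊗ δ X) ⨾ α⁻ Y X X ⨾ (P ⊗ π) ⨾ λ⁺ Y
      ≡⟨ cong (λ k → (id Y ⊗ δ X) ⨾ α⁻ Y X X ⨾ k ⨾ λ⁺ Y)
           (trans (cong (P ⊗_) (sym (⨾-idʳ π))) (⊗-⨾ (id Y ⊗ π) (δ* Y ⨾ ε Y) π (id Y))) ⟩
    (id Y ⊗ δ X) ⨾ α⁻ Y X X ⨾ (((id Y ⊗ π) ⊗ π) ⨾ ((δ* Y ⨾ ε Y) ⊗ id Y)) ⨾ λ⁺ Y
      ≡⟨ cong ((id Y ⊗ δ X) ⨾_) (trans (cong (α⁻ Y X X ⨾_) (⨾-assoc _ _ _))
           (trans (⨾-pullˡ _ (sym (α⁻-natural (id Y) π π))) (⨾-assoc _ _ _))) ⟩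
    (id Y ⊗ δ X) ⨾ (id Y ⊗ (π ⊗ π)) ⨾ α⁻ Y Y Y ⨾ ((δ* Y ⨾ ε Y) ⊗ id Y) ⨾ λ⁺ Y
      ≡⟨ ⨾-pullˡ _ (trans (sym (id⊗-⨾ (δ X) (π ⊗ π))) (trans (cong (id Y ⊗_) map-δ) (id⊗-⨾ π (δ Y)))) ⟩
    ((id Y ⊗ π) ⨾ (id Y ⊗ δ Y)) ⨾ α⁻ Y Y Y ⨾ ((δ* Y ⨾ ε Y) ⊗ id Y) ⨾ λ⁺ Y
      ≡⟨ ⨾-assoc _ _ _ ⟩
    (id Y ⊗ π) ⨾ (id Y ⊗ δ Y) ⨾ α⁻ Y Y Y ⨾ ((δ* Y ⨾ ε Y) ⊗ id Y) ⨾ λ⁺ Y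
      ≡⟨ cong ((id Y ⊗ π) ⨾_) (frobenius-counit Y) ⟩
    (id Y ⊗ π) ⨾ δ* Y ∎
    where
    open ≡-Reasoning
    P : Hom (Y ⊗₀ X) I
    P = (id Y ⊗ π) ⨾ δ* Y ⨾ ε Y
    map-δ : δ X ⨾ (π ⊗ π) ≡ π ⨾ δ Y
    map-δ = ≤-antisym (proj₁ isMap) (δ-lax π)

  restrict-image-factors : ∀ {X Y} (π : Hom X Y) → IsMap π →
                     restrict (ε* X ⨾ π) ≡ (ρ⁻ Y ⨾ (id Y ⊗ ε* X) ⨾ graphFilter π) ⨾ π
  restrict-image-factors {X} {Y} π isMap = begin
    ρ⁻ Y ⨾ (id Y ⊗ (ε* X ⨾ π)) ⨾ δ* Y                 ≡⟨ cong (λ k → ρ⁻ Y ⨾ k ⨾ δ* Y) (id⊗-⨾ (ε* X) π) ⟩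
    ρ⁻ Y ⨾ ((id Y ⊗ ε* X) ⨾ (id Y ⊗ π)) ⨾ δ* Y        ≡⟨ cong (ρ⁻ Y ⨾_) (⨾-assoc _ _ _) ⟩
    ρ⁻ Y ⨾ (id Y ⊗ ε* X) ⨾ (id Y ⊗ π) ⨾ δ* Y          ≡⟨ cong (λ k → ρ⁻ Y ⨾ (id Y ⊗ ε* X) ⨾ k) (graphFilter-⨾ π isMap) ⟨
    ρ⁻ Y ⨾ (id Y ⊗ ε* X) ⨾ graphFilter π ⨾ π          ≡⟨ trans (cong (ρ⁻ Y ⨾_) (sym (⨾-assoc _ _ _))) (sym (⨾-assoc _ _ _)) ⟩
    (ρ⁻ Y ⨾ (id Y ⊗ ε* X) ⨾ graphFilter π) ⨾ π        ∎
    where open ≡-Reasoning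

  surjective-map⇒split : ∀ {X Y} (π : Hom X Y) → IsMap π → IsSurjective π →
                         Σ[ G ∈ Hom Y X ] G ⨾ π ≡ id Y
  surjective-map⇒split {X} {Y} π isMap surjective =
    ρ⁻ Y ⨾ (id Y ⊗ ε* X) ⨾ graphFilter π ,
    trans (sym (restrict-image-factors π isMap))
          (≤-antisym (restrict≤id (ε* X ⨾ π)) (ε*≤⇒id≤restrict (ε* X ⨾ π) surjective))

  split⇒epi : ∀ {X Y} {π : Hom X Y} {G : Hom Y X} → G ⨾ π ≡ id Y → IsEpi π
  split⇒epi {π = π} {G} G⨾π≡id Z R S π⨾R≡π⨾S = begin
    R             ≡⟨ ⨾-cancelˡ R G⨾π≡id ⟨
    G ⨾ π ⨾ R     ≡⟨ cong (G ⨾_) π⨾R≡π⨾S ⟩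
    G ⨾ π ⨾ S     ≡⟨ ⨾-cancelˡ S G⨾π≡id ⟩
    S             ∎
    where open ≡-Reasoning

  surjective-map⇒epi : ∀ {X Y} (π : Hom X Y) → IsMap π → IsSurjective π → IsEpi π
  surjective-map⇒epi π isMap surjective = split⇒epi (proj₂ (surjective-map⇒split π isMap surjective))

lemma4p4 : ∀ {o h ℓ} (B : CartesianBicategory o h ℓ) →
    let open CartesianBicategory B in
    ∀ {X Y} (π : Hom X Y) → IsMap π →
    (IsEpi π → IsSurjective π) × (IsSurjective π → IsEpi π)
lemma4p4 B π isMap = epi⇒surjective π , surjective-map⇒epi π isMap
  where open CartesianBicategoryProperties B
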